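{- Let $q$ be a prime power, $m$ a positive integer and $k\ge3$. If $U$ is an $\mathbb{F}_q$-subspace of $\mathbb{F}_{q^m}^k$ of dimension $n$ such that $L_U$ is an $m$-club in $\mathrm{PG}(k-1,q^m)$, then \[ n\le \frac{m(k-1)}{2}+m.\]
   Context: $L_U=\{\langle u\rangle_{\mathbb{F}_{q^m}} : u\in U\setminus\{0\}\}$; the weight of a point $\langle v\rangle_{\mathbb{F}_{q^m}}$ is $\dim_{\mathbb{F}_q}(U\cap\langle v\rangle_{\mathbb{F}_{q^m}})$; $L_U$ is an $i$-club if exactly one point of $L_U$ has weight $i$ and all others weight $1$. -}

module Defs where

open import Level using (Level; _⊔_; suc)
open import Data.Nat using (ℕ; _^_; _≤_)
open import Data.Nat.Primality using (Prime)
open import Data.Fin using (Fin)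
open import Data.Product using (Σ; ∃; _×_; _,_)
open import Data.Sum using (_⊎_)
open import Data.Vec using (Vec; []; _∷_; lookup; replicate; zipWith; map)
open import Data.Vec.Relation.Unary.All using (All)
open import Data.Vec.Relation.Unary.Any using (Any)
open import Data.Vec.Relation.Binary.Pointwise.Inductive using (Pointwise)
open import Relation.Nullary using (¬_)
open import Relation.Binary.PropositionalEquality using (_≡_)
open import Relation.Unary using (Pred)
open import Algebra.Bundles using (CommutativeRing)

IsPrimePower : ℕ → Set
IsPrimePower q = Σ ℕ λ p → Σ ℕ λ e → Prime p × 1 ≤ e × q ≡ p ^ e

module Over {c ℓ : Level} (R : CommutativeRing c ℓ) where
  open CommutativeRing R

  IsField : Set (c ⊔ ℓ)
  IsField = (¬ (1# ≈ 0#)) × (∀ x → ¬ (x ≈ 0#) → ∃ λ y → (x * y) ≈ 1#)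

  HasSize : ∀ {p} → Pred Carrier p → ℕ → Set (c ⊔ ℓ ⊔ p)
  HasSize P s = Σ (Vec Carrier s) λ xs →
    All P xs × (∀ x → P x → Any (x ≈_) xs)
      × (∀ i j → lookup xs i ≈ lookup xs j → i ≡ j)

  record IsSubfield {p} (K : Pred Carrier p) : Set (c ⊔ ℓ ⊔ p) where
    field
      resp : ∀ {x y} → x ≈ y → K x → K y
      zero∈ : K 0#
      one∈ : K 1#
      +-closed : ∀ {x y} → K x → K y → K (x + y)
      neg-closed : ∀ {x} → K x → K (- x)
      *-closed : ∀ {x y} → K x → K y → K (x * y)
      inv-closed : ∀ {x y} → K x → (x * y) ≈ 1# → K y

  V : ℕ → Set c
  V k = Vec Carrier k

  _≋_ : ∀ {k} → V k → V k → Set (c ⊔ ℓ)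
  _≋_ = Pointwise _≈_

  0v : ∀ {k} → V k
  0v {k} = replicate k 0#

  _+v_ : ∀ {k} → V k → V k → V k
  _+v_ = zipWith _+_

  _·v_ : ∀ {k} → Carrier → V k → V k
  a ·v u = map (a *_) u

  lincomb : ∀ {k d} → Vec Carrier d → Vec (V k) d → V k
  lincomb [] [] = 0v
  lincomb (a ∷ as) (u ∷ us) = (a ·v u) +v lincomb as us

  record IsSubspace {p r} (K : Pred Carrier p) {k} (W : Pred (V k) r)
         : Set (c ⊔ ℓ ⊔ p ⊔ r) where
    field
      resp : ∀ {u v} → u ≋ v → W u → W v
      zero∈ : W 0v
      +-closed : ∀ {u v} → W u → W v → W (u +v v)
      ·-closed : ∀ {a u} → K a → W u → W (a ·v u)

  HasDim : ∀ {p r} (K : Pred Carrier p) {k} (W : Pred (V k) r) → ℕ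
         → Set (c ⊔ ℓ ⊔ p ⊔ r)
  HasDim K {k} W d = Σ (Vec (V k) d) λ b →
      All W b
    × (∀ (as : Vec Carrier d) → All K as → lincomb as b ≋ 0v → All (_≈ 0#) as)
    × (∀ w → W w → Σ (Vec Carrier d) λ as → All K as × (w ≋ lincomb as b))

  ⟨_⟩ : ∀ {k} → V k → Pred (V k) (c ⊔ ℓ)
  ⟨ v ⟩ w = ∃ λ a → w ≋ (a ·v v)

  -- the point ⟨u⟩ equals the point ⟨v⟩ (u, v nonzero)
  SamePoint : ∀ {k} → V k → V k → Set (c ⊔ ℓ)
  SamePoint u v = ∃ λ a → (¬ (a ≈ 0#)) × (u ≋ (a ·v v))

  HasWeight : ∀ {p r} (K : Pred Carrier p) {k} (U : Pred (V k) r) → V k → ℕ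
            → Set (c ⊔ ℓ ⊔ p ⊔ r)
  HasWeight K U v w = HasDim K (λ x → U x × ⟨ v ⟩ x) w

  -- L_U is an i-club: exactly one point of L_U has weight i, all others weight 1
  IsClub : ∀ {p r} (K : Pred Carrier p) {k} (U : Pred (V k) r) → ℕ
         → Set (c ⊔ ℓ ⊔ p ⊔ r)
  IsClub K {k} U i = Σ (V k) λ u₀ →
      U u₀ × (¬ (u₀ ≋ 0v)) × HasWeight K U u₀ i
    × (∀ u → U u → ¬ (u ≋ 0v) → HasWeight K U u i → SamePoint u u₀)
    × (∀ u → U u → ¬ (u ≋ 0v) → ¬ SamePoint u u₀ → HasWeight K U u 1)

{-# OPTIONS --safe #-}
module Submission where

open import Defs
open import Level using (Level; _⊔_)
open import Algebra.Bundles using (CommutativeRing; CommutativeMonoid)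
open import Algebra.Structures using (IsCommutativeMonoid)
import Algebra.Properties.CommutativeSemigroup as CommutativeSemigroupProperties
import Algebra.Properties.Ring as RingProperties
open import Data.Empty using (⊥-elim)
open import Data.Fin using (Fin; zero; suc) renaming (_≟_ to _≟ᶠ_)
open import Data.Fin.Properties using (injective⇒≤)
open import Data.Nat using (ℕ; zero; suc; _^_; _≤_; _<_; _≤?_; z≤n; s≤s)
open import Data.Nat.Base using (nonTrivial⇒n>1)
open import Data.Nat.Primality using (prime⇒nonTrivial)
open import Data.Nat.Properties using (≮⇒≥; <⇒≱; ^-monoʳ-<; ^-*-assoc; n≮n; ≤-trans; ≤-antisym)
open import Data.Product using (Σ; ∃; ∃-syntax; _×_; _,_; proj₁; proj₂)
open import Data.Vec using (Vec; []; _∷_; _++_; lookup; map; replicate; zipWith; splitAt)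
open import Data.Vec.Recursive using (Fin[m^n]↔Fin[m]^n)
open import Data.Vec.Recursive.Properties using (↔Vec)
open import Data.Vec.Relation.Binary.Pointwise.Inductive as Pointwise using ([]; _∷_)
open import Data.Vec.Relation.Unary.All as All using (All; []; _∷_)
open import Data.Vec.Relation.Unary.All.Properties using (lookup⁺; map⁺; ++⁺; ++⁻)
open import Data.Vec.Relation.Unary.Any as Any using (Any)
open import Data.Vec.Relation.Unary.Any.Properties using (lookup-index)
open import Function using (_∘_; _↔_; Inverse; Injection)
open import Function.Properties.Inverse using (↔-trans; ↔⇒↣)
open import Relation.Binary.PropositionalEquality as ≡ using (_≡_)
import Relation.Binary.Reasoning.Setoid as SetoidReasoning
open import Relation.Nullary using (¬_; yes; no)
open import Relation.Nullary.Decidable using (decidable-stable; ¬¬-excluded-middle)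
open import Relation.Nullary.Negation using (¬¬-map)
open import Relation.Unary using (Pred)

-- Let u₀ span the point of weight m, and let b₁, …, b_t ∈ U be K-independent modulo ⟨u₀⟩ and
-- span U modulo ⟨u₀⟩. Together with a K-basis c₁, …, c_m of U ∩ ⟨u₀⟩ they span U, so n ≤ m + t.
-- Every y ∈ U outside ⟨u₀⟩ spans a point of weight 1, that is U ∩ ⟨y⟩ = K y, so λ y ∈ U forces
-- λ ∈ K. Hence for λ ∉ K the vectors λ bᵢ, bᵢ, cⱼ are K-independent in F^k: in a relation
-- λ y + x + z = 0 (y and x combinations of the bᵢ, z of the cⱼ) either y ∈ ⟨u₀⟩, and then all
-- coefficients vanish, or λ y = -(x + z) ∈ U. So 2t + m ≤ mk, and 2n ≤ 2t + 2m ≤ m(k - 1) + 2m.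
-- If K = F then m = 1 and t = 0, since any y ∈ U outside ⟨u₀⟩ would be a second point of weight m.
--
-- Dimensions are compared by counting: M K-independent vectors have q^M distinct K-combinations.
-- Equality in F need not be decidable, so the argument runs in the double-negation monad; this is
-- harmless because the conclusion is a decidable inequality of natural numbers.

private
  variable
    ℓ₁ ℓ₂ ℓ₃ : Level
    A B : Set ℓ₁

infixl 1 _>>=_

_>>=_ : ¬ ¬ A → (A → ¬ ¬ B) → ¬ ¬ B
(¬¬x >>= f) ¬y = ¬¬x (λ x → f x ¬y)

return : A → ¬ ¬ A
return x ¬x = ¬x x

¬¬-Π-Fin : ∀ n {P : Fin n → Set ℓ₁} → (∀ i → ¬ ¬ P i) → ¬ ¬ (∀ i → P i)
¬¬-Π-Fin zero    _   = return λ ()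
¬¬-Π-Fin (suc n) ¬¬P = do
  p₀ ← ¬¬P zero
  p  ← ¬¬-Π-Fin n (¬¬P ∘ suc)
  return λ { zero → p₀ ; (suc i) → p i }

¬∀¬¬⇒¬¬∃¬ : ∀ {P : Pred A ℓ₂} {Q : Pred A ℓ₃} →
            ¬ (∀ x → P x → ¬ ¬ Q x) → ¬ ¬ (∃[ x ] (P x × ¬ Q x))
¬∀¬¬⇒¬¬∃¬ ¬∀ ¬∃ = ¬∀ λ x px ¬qx → ¬∃ (x , px , ¬qx)

replicate⁺ : ∀ {P : Pred A ℓ₂} {x} n → P x → All P (replicate n x)
replicate⁺ zero    _  = []
replicate⁺ (suc n) px = px ∷ replicate⁺ n px

^-cancelˡ-≤ : ∀ q {m n} → 1 < q → q ^ m ≤ q ^ n → m ≤ n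
^-cancelˡ-≤ q 1<q q^m≤q^n = ≮⇒≥ (λ n<m → <⇒≱ (^-monoʳ-< q 1<q n<m) q^m≤q^n)

primePower>1 : ∀ {q} → IsPrimePower q → 1 < q
primePower>1 (p , _ , p-prime , 1≤e , ≡.refl) =
  ^-monoʳ-< p (nonTrivial⇒n>1 p {{prime⇒nonTrivial p-prime}}) 1≤e

module LinearAlgebra {c ℓ} (F : CommutativeRing c ℓ) where
  open CommutativeRing F hiding (zero)
  open Over F public
    renaming (_≋_ to infix 4 _≋_; _+v_ to infixl 6 _+v_; _·v_ to infixr 7 _·v_)
  open import Data.Vec.Relation.Binary.Equality.Setoid setoid public
    using (≋-refl; ≋-sym; ≋-trans; ≋-setoid)

  module ≋-Reasoning {k : ℕ} = SetoidReasoning (≋-setoid k)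

  +v-isCommutativeMonoid : ∀ k → IsCommutativeMonoid (_≋_ {k}) _+v_ 0v
  +v-isCommutativeMonoid k = record
    { isMonoid = record
      { isSemigroup = record
        { isMagma  = record
          { isEquivalence = Pointwise.isEquivalence isEquivalence k
          ; ∙-cong        = Pointwise.zipWith-cong +-cong
          }
        ; assoc = Pointwise.zipWith-assoc +-assoc
        }
      ; identity = Pointwise.zipWith-identityˡ +-identityˡ , Pointwise.zipWith-identityʳ +-identityʳ
      }
    ; comm = Pointwise.zipWith-comm +-comm
    }

  +v-commutativeMonoid : ℕ → CommutativeMonoid c (c ⊔ ℓ)
  +v-commutativeMonoid k = record { isCommutativeMonoid = +v-isCommutativeMonoid k }

  module _ {k : ℕ} where
    open CommutativeMonoid (+v-commutativeMonoid k) public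
      using ()
      renaming ( ∙-cong to +v-cong; assoc to +v-assoc
               ; identityˡ to +v-identityˡ; identityʳ to +v-identityʳ)
    open CommutativeSemigroupProperties (CommutativeMonoid.commutativeSemigroup (+v-commutativeMonoid k))
      public using () renaming (interchange to +v-interchange)

  ·v-cong : ∀ {k a b} {u v : V k} → a ≈ b → u ≋ v → a ·v u ≋ b ·v v
  ·v-cong a≈b = Pointwise.map⁺ (*-cong a≈b)

  ·v-distribˡ : ∀ {k} a (u v : V k) → a ·v (u +v v) ≋ a ·v u +v a ·v v
  ·v-distribˡ a []      []      = []
  ·v-distribˡ a (x ∷ u) (y ∷ v) = distribˡ a x y ∷ ·v-distribˡ a u v

  ·v-distribʳ : ∀ {k} a b (u : V k) → (a + b) ·v u ≋ a ·v u +v b ·v u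
  ·v-distribʳ a b []      = []
  ·v-distribʳ a b (x ∷ u) = distribʳ x a b ∷ ·v-distribʳ a b u

  ·v-assoc : ∀ {k} a b (u : V k) → (a * b) ·v u ≋ a ·v b ·v u
  ·v-assoc a b []      = []
  ·v-assoc a b (x ∷ u) = *-assoc a b x ∷ ·v-assoc a b u

  ·v-identityˡ : ∀ {k} (u : V k) → 1# ·v u ≋ u
  ·v-identityˡ []      = []
  ·v-identityˡ (x ∷ u) = *-identityˡ x ∷ ·v-identityˡ u

  ·v-zeroˡ : ∀ {k} (u : V k) → 0# ·v u ≋ 0v
  ·v-zeroˡ []      = []
  ·v-zeroˡ (x ∷ u) = zeroˡ x ∷ ·v-zeroˡ u

  ·v-zeroʳ : ∀ {k} a → a ·v 0v {k} ≋ 0v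
  ·v-zeroʳ {zero}  a = []
  ·v-zeroʳ {suc k} a = zeroʳ a ∷ ·v-zeroʳ a

  ·v-comm : ∀ {k} a b (u : V k) → a ·v b ·v u ≋ b ·v a ·v u
  ·v-comm a b u = begin
    a ·v b ·v u   ≈⟨ ·v-assoc a b u ⟨
    (a * b) ·v u  ≈⟨ ·v-cong (*-comm a b) ≋-refl ⟩
    (b * a) ·v u  ≈⟨ ·v-assoc b a u ⟩
    b ·v a ·v u   ∎
    where open ≋-Reasoning

  +v-inverseʳ : ∀ {k} (u : V k) → u +v (- 1#) ·v u ≋ 0v
  +v-inverseʳ []      = []
  +v-inverseʳ (x ∷ u) = trans (+-congˡ (-1*x≈-x x)) (-‿inverseʳ x) ∷ +v-inverseʳ u
    where open RingProperties ring using (-1*x≈-x)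

  +v-cancelʳ : ∀ {k} (u v : V k) → (u +v v) +v (- 1#) ·v v ≋ u
  +v-cancelʳ u v = begin
    (u +v v) +v (- 1#) ·v v  ≈⟨ +v-assoc u v _ ⟩
    u +v (v +v (- 1#) ·v v)  ≈⟨ +v-cong ≋-refl (+v-inverseʳ v) ⟩
    u +v 0v                  ≈⟨ +v-identityʳ u ⟩
    u                        ∎
    where open ≋-Reasoning

  lincomb-cong : ∀ {k d} {as bs : Vec Carrier d} (vs : Vec (V k) d) →
                 as ≋ bs → lincomb as vs ≋ lincomb bs vs
  lincomb-cong []       []            = ≋-refl
  lincomb-cong (v ∷ vs) (a≈b ∷ as≋bs) = +v-cong (·v-cong a≈b ≋-refl) (lincomb-cong vs as≋bs)

  lincomb-zero : ∀ {k d} {as : Vec Carrier d} (vs : Vec (V k) d) → All (_≈ 0#) as → lincomb as vs ≋ 0v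
  lincomb-zero                []       []           = ≋-refl
  lincomb-zero {as = a ∷ as} (v ∷ vs) (a≈0 ∷ as≈0) = begin
    a ·v v +v lincomb as vs  ≈⟨ +v-cong (·v-cong a≈0 ≋-refl) (lincomb-zero vs as≈0) ⟩
    0# ·v v +v 0v            ≈⟨ +v-cong (·v-zeroˡ v) ≋-refl ⟩
    0v +v 0v                 ≈⟨ +v-identityˡ 0v ⟩
    0v                       ∎
    where open ≋-Reasoning

  lincomb-+ : ∀ {k d} (as bs : Vec Carrier d) (vs : Vec (V k) d) →
              lincomb (zipWith _+_ as bs) vs ≋ lincomb as vs +v lincomb bs vs
  lincomb-+ []       []       []       = ≋-sym (+v-identityˡ 0v)
  lincomb-+ (a ∷ as) (b ∷ bs) (v ∷ vs) =
    ≋-trans (+v-cong (·v-distribʳ a b v) (lincomb-+ as bs vs)) (+v-interchange _ _ _ _)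

  lincomb-scale : ∀ {k d} e (as : Vec Carrier d) (vs : Vec (V k) d) →
                  lincomb (map (e *_) as) vs ≋ e ·v lincomb as vs
  lincomb-scale e []       []       = ≋-sym (·v-zeroʳ e)
  lincomb-scale e (a ∷ as) (v ∷ vs) =
    ≋-trans (+v-cong (·v-assoc e a v) (lincomb-scale e as vs)) (≋-sym (·v-distribˡ e _ _))

  lincomb-++ : ∀ {k d d′} (as : Vec Carrier d) (bs : Vec Carrier d′) (us : Vec (V k) d) (vs : Vec (V k) d′) →
               lincomb (as ++ bs) (us ++ vs) ≋ lincomb as us +v lincomb bs vs
  lincomb-++ []       bs []       vs = ≋-sym (+v-identityˡ _)
  lincomb-++ (a ∷ as) bs (u ∷ us) vs =
    ≋-trans (+v-cong ≋-refl (lincomb-++ as bs us vs)) (≋-sym (+v-assoc _ _ _))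

  lincomb-map-·v : ∀ {k d} l (as : Vec Carrier d) (vs : Vec (V k) d) →
                   lincomb as (map (l ·v_) vs) ≋ l ·v lincomb as vs
  lincomb-map-·v l []       []       = ≋-sym (·v-zeroʳ l)
  lincomb-map-·v l (a ∷ as) (v ∷ vs) =
    ≋-trans (+v-cong (·v-comm a l v) (lincomb-map-·v l as vs)) (≋-sym (·v-distribˡ l _ _))

  module Tuples {p s} {P : Pred Carrier p} (P-size : HasSize P s) where

    private
      elems : Vec Carrier s
      elems = proj₁ P-size

      elems∈P : All P elems
      elems∈P = proj₁ (proj₂ P-size)

      covers : ∀ x → P x → Any (x ≈_) elems
      covers = proj₁ (proj₂ (proj₂ P-size))

      distinct : ∀ i j → lookup elems i ≈ lookup elems j → i ≡ j
      distinct = proj₂ (proj₂ (proj₂ P-size))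

      index-tuples : ∀ M → Fin (s ^ M) ↔ Vec (Fin s) M
      index-tuples M = ↔-trans (Fin[m^n]↔Fin[m]^n s M) (↔Vec M)

      lookup-injective : ∀ {M} (is js : Vec (Fin s) M) →
                         map (lookup elems) is ≋ map (lookup elems) js → is ≡ js
      lookup-injective []       []       []         = ≡.refl
      lookup-injective (i ∷ is) (j ∷ js) (eq ∷ eqs) =
        ≡.cong₂ _∷_ (distinct i j eq) (lookup-injective is js eqs)

      indices : ∀ {M} {as : Vec Carrier M} → All P as → Σ (Vec (Fin s) M) λ is → map (lookup elems) is ≋ as
      indices []                        = [] , []
      indices {as = a ∷ _} (a∈P ∷ as∈P) =
        let is , is≋as = indices as∈P ; hit = covers a a∈P
        in Any.index hit ∷ is , sym (lookup-index hit) ∷ is≋as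

    tuple : ∀ M → Fin (s ^ M) → Vec Carrier M
    tuple M = map (lookup elems) ∘ Inverse.to (index-tuples M)

    tuple∈P : ∀ M t → All P (tuple M t)
    tuple∈P M t = map⁺ (All.universal (lookup⁺ elems∈P) _)

    tuple-injective : ∀ M {t t′} → tuple M t ≋ tuple M t′ → t ≡ t′
    tuple-injective M eq = Injection.injective (↔⇒↣ (index-tuples M)) (lookup-injective _ _ eq)

    tuple-surjective : ∀ {M} {as : Vec Carrier M} → All P as → ∃ λ t → tuple M t ≋ as
    tuple-surjective {M} {as} as∈P =
      let is , is≋as = indices as∈P
          to∘from≡id = Inverse.strictlyInverseˡ (index-tuples M) is
      in Inverse.from (index-tuples M) is
       , ≡.subst (λ js → map (lookup elems) js ≋ as) (≡.sym to∘from≡id) is≋as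

module Subspaces {c ℓ p} {F : CommutativeRing c ℓ} (F-field : Over.IsField F)
                 {K : Pred (CommutativeRing.Carrier F) p} (K-subfield : Over.IsSubfield F K) where
  open CommutativeRing F hiding (zero)
  open RingProperties ring using (-1*x≈-x; [y-z]x≈yx-zx; x≈y⇒x∙y⁻¹≈ε; x∙y⁻¹≈ε⇒x≈y)
  open LinearAlgebra F
  private
    module K = IsSubfield K-subfield

  -1∈K : K (- 1#)
  -1∈K = K.neg-closed K.one∈

  scale∈K : ∀ {d e} {as : Vec Carrier d} → K e → All K as → All K (map (e *_) as)
  scale∈K e∈K as∈K = map⁺ (All.map (K.*-closed e∈K) as∈K)

  ax≈bx⇒x≈0 : ∀ {a b x} → ¬ a ≈ b → a * x ≈ b * x → x ≈ 0#
  ax≈bx⇒x≈0 {a} {b} {x} a≉b ax≈bx with proj₂ F-field (a - b) (a≉b ∘ x∙y⁻¹≈ε⇒x≈y a b)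
  ... | e , [a-b]e≈1 = begin
    x                    ≈⟨ *-identityˡ x ⟨
    1# * x               ≈⟨ *-congʳ (trans (*-comm e _) [a-b]e≈1) ⟨
    (e * (a - b)) * x    ≈⟨ *-assoc e _ x ⟩
    e * ((a - b) * x)    ≈⟨ *-congˡ ([y-z]x≈yx-zx x a b) ⟩
    e * (a * x - b * x)  ≈⟨ *-congˡ (x≈y⇒x∙y⁻¹≈ε ax≈bx) ⟩
    e * 0#               ≈⟨ zeroʳ e ⟩
    0#                   ∎
    where open SetoidReasoning setoid

  ·v-cancelʳ : ∀ {k a b} {u : V k} → ¬ u ≋ 0v → a ·v u ≋ b ·v u → ¬ ¬ a ≈ b
  ·v-cancelʳ {a = a} {b} u≢0 au≋bu a≉b = u≢0 (components au≋bu)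
    where
    components : ∀ {k} {u : V k} → a ·v u ≋ b ·v u → u ≋ 0v
    components {u = []}    []       = []
    components {u = _ ∷ _} (e ∷ es) = ax≈bx⇒x≈0 a≉b e ∷ components es

  ≋0⇒∈ : ∀ {k r} {W : Pred (V k) r} {u} → IsSubspace K W → u ≋ 0v → W u
  ≋0⇒∈ W-subspace u≋0 = IsSubspace.resp W-subspace (≋-sym u≋0) (IsSubspace.zero∈ W-subspace)

  ∉subspace⇒≢0 : ∀ {k r} {W : Pred (V k) r} {y} → IsSubspace K W → ¬ W y → ¬ y ≋ 0v
  ∉subspace⇒≢0 W-subspace y∉W = y∉W ∘ ≋0⇒∈ W-subspace

  lincomb∈ : ∀ {k d r} {W : Pred (V k) r} → IsSubspace K W →
             ∀ {as : Vec Carrier d} {vs : Vec (V k) d} → All K as → All W vs → W (lincomb as vs)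
  lincomb∈ W-subspace []           []           = zero∈
    where open IsSubspace W-subspace
  lincomb∈ W-subspace (a∈K ∷ as∈K) (v∈W ∷ vs∈W) =
    +-closed (·-closed a∈K v∈W) (lincomb∈ W-subspace as∈K vs∈W)
    where open IsSubspace W-subspace

  ∈-cancelʳ : ∀ {k r} {W : Pred (V k) r} → IsSubspace K W → ∀ {u v} → W v → W (u +v v) → W u
  ∈-cancelʳ W-subspace {u} {v} v∈W u+v∈W = resp (+v-cancelʳ u v) (+-closed u+v∈W (·-closed -1∈K v∈W))
    where open IsSubspace W-subspace

  line-subspace : ∀ {k} (u : V k) → IsSubspace K ⟨ u ⟩
  line-subspace u = record
    { resp     = λ { v≋w (a , v≋au) → a , ≋-trans (≋-sym v≋w) v≋au }
    ; zero∈    = 0# , ≋-sym (·v-zeroˡ u)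
    ; +-closed = λ { (a , v≋au) (b , w≋bu) →
                     a + b , ≋-trans (+v-cong v≋au w≋bu) (≋-sym (·v-distribʳ a b u)) }
    ; ·-closed = λ { {a} _ (b , v≋bu) → a * b , ≋-trans (·v-cong refl v≋bu) (≋-sym (·v-assoc a b u)) }
    }

  IndependentMod : ∀ {k s N} → Pred (V k) s → Vec (V k) N → Set (c ⊔ ℓ ⊔ p ⊔ s)
  IndependentMod S vs = ∀ as → All K as → S (lincomb as vs) → ¬ ¬ All (_≈ 0#) as

  Independent : ∀ {k N} → Vec (V k) N → Set (c ⊔ ℓ ⊔ p)
  Independent = IndependentMod (_≋ 0v)

  InSpan : ∀ {k N} → Vec (V k) N → Pred (V k) (c ⊔ ℓ ⊔ p)
  InSpan vs u = ∃[ as ] (All K as × u ≋ lincomb as vs)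

  InSpanMod : ∀ {k s N} → Pred (V k) s → Vec (V k) N → Pred (V k) (c ⊔ ℓ ⊔ p ⊔ s)
  InSpanMod S vs u = ∃[ w ] (S w × ∃[ as ] (All K as × u ≋ w +v lincomb as vs))

  Spans : ∀ {k r N} → Pred (V k) r → Vec (V k) N → Set (c ⊔ ℓ ⊔ p ⊔ r)
  Spans W vs = ∀ u → W u → ¬ ¬ InSpan vs u

  basis-independent : ∀ {k r d} {W : Pred (V k) r} (W-dim : HasDim K W d) → Independent (proj₁ W-dim)
  basis-independent (_ , _ , independent , _) as as∈K comb≋0 = return (independent as as∈K comb≋0)

  basis-spans : ∀ {k r d} {W : Pred (V k) r} (W-dim : HasDim K W d) → Spans W (proj₁ W-dim)
  basis-spans (_ , _ , _ , spans) u u∈W = return (spans u u∈W)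

  independentMod⇒independent : ∀ {k s N} {S : Pred (V k) s} {vs : Vec (V k) N} →
                               IsSubspace K S → IndependentMod S vs → Independent vs
  independentMod⇒independent S-subspace independent as as∈K comb≋0 =
    independent as as∈K (≋0⇒∈ S-subspace comb≋0)

  independent⇒lincomb-injective : ∀ {k N} {vs : Vec (V k) N} {as bs} → Independent vs →
                                  All K as → All K bs → lincomb as vs ≋ lincomb bs vs → ¬ ¬ as ≋ bs
  independent⇒lincomb-injective {vs = vs} {as} {bs} independent as∈K bs∈K as≋bs =
    ¬¬-map (differences≈0 as bs)
           (independent as-bs (All.zipWith K.+-closed as∈K (scale∈K -1∈K bs∈K)) as-bs≋0)
    where
    as-bs : Vec Carrier _
    as-bs = zipWith _+_ as (map (- 1# *_) bs)
    as-bs≋0 : lincomb as-bs vs ≋ 0v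
    as-bs≋0 = begin
      lincomb as-bs vs                                ≈⟨ lincomb-+ as _ vs ⟩
      lincomb as vs +v lincomb (map (- 1# *_) bs) vs  ≈⟨ +v-cong as≋bs (lincomb-scale (- 1#) bs vs) ⟩
      lincomb bs vs +v (- 1#) ·v lincomb bs vs        ≈⟨ +v-inverseʳ _ ⟩
      0v                                              ∎
      where open ≋-Reasoning
    differences≈0 : ∀ {d} (as bs : Vec Carrier d) →
                    All (_≈ 0#) (zipWith _+_ as (map (- 1# *_) bs)) → as ≋ bs
    differences≈0 []       []       []                = []
    differences≈0 (a ∷ as) (b ∷ bs) (a-b≈0 ∷ as-bs≈0) =
      x∙y⁻¹≈ε⇒x≈y a b (trans (+-congˡ (sym (-1*x≈-x b))) a-b≈0) ∷ differences≈0 as bs as-bs≈0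

  independentMod⇒head∉ : ∀ {k s N} {S : Pred (V k) s} {u} {vs : Vec (V k) N} →
                         IsSubspace K S → IndependentMod S (u ∷ vs) → ¬ S u
  independentMod⇒head∉ {N = N} {S} {u} {vs} S-subspace independent u∈S =
    independent (1# ∷ replicate N 0#) (K.one∈ ∷ replicate⁺ N K.zero∈) comb∈S
      λ { (1≈0 ∷ _) → proj₁ F-field 1≈0 }
    where
    comb≋u : 1# ·v u +v lincomb (replicate N 0#) vs ≋ u
    comb≋u = ≋-trans (+v-cong (·v-identityˡ u) (lincomb-zero vs (replicate⁺ N refl))) (+v-identityʳ u)
    comb∈S : S (1# ·v u +v lincomb (replicate N 0#) vs)
    comb∈S = IsSubspace.resp S-subspace (≋-sym comb≋u) u∈S

  head∈spanMod : ∀ {k s N} {S : Pred (V k) s} {u} {vs : Vec (V k) N} {a as} → IsSubspace K S →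
                 K a → ¬ a ≈ 0# → All K as → S (a ·v u +v lincomb as vs) → InSpanMod S vs u
  head∈spanMod {u = u} {vs} {a} {as} S-subspace a∈K a≉0 as∈K comb∈S with proj₂ F-field a a≉0
  ... | e , ae≈1 =
    e ·v (a ·v u +v L) , IsSubspace.·-closed S-subspace e∈K comb∈S ,
    map (- 1# *_) (map (e *_) as) , scale∈K -1∈K (scale∈K e∈K as∈K) , ≋-sym (begin
      e ·v (a ·v u +v L) +v lincomb (map (- 1# *_) (map (e *_) as)) vs
        ≈⟨ +v-cong (·v-distribˡ e _ L) (lincomb-scale (- 1#) (map (e *_) as) vs) ⟩
      (e ·v a ·v u +v e ·v L) +v (- 1#) ·v lincomb (map (e *_) as) vs
        ≈⟨ +v-cong (+v-cong eau≋u ≋-refl) (·v-cong refl (lincomb-scale e as vs)) ⟩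
      (u +v e ·v L) +v (- 1#) ·v e ·v L
        ≈⟨ +v-cancelʳ u (e ·v L) ⟩
      u ∎)
    where
    open ≋-Reasoning
    L : V _
    L = lincomb as vs
    e∈K : K e
    e∈K = K.inv-closed a∈K ae≈1
    eau≋u : e ·v a ·v u ≋ u
    eau≋u = begin
      e ·v a ·v u   ≈⟨ ·v-assoc e a u ⟨
      (e * a) ·v u  ≈⟨ ·v-cong (trans (*-comm e a) ae≈1) ≋-refl ⟩
      1# ·v u       ≈⟨ ·v-identityˡ u ⟩
      u             ∎

  ∉span⇒independentMod-∷ : ∀ {k s N} {S : Pred (V k) s} {u} {vs : Vec (V k) N} → IsSubspace K S →
                           IndependentMod S vs → ¬ InSpanMod S vs u → IndependentMod S (u ∷ vs)
  ∉span⇒independentMod-∷ {u = u} {vs} S-subspace independent u∉span (a ∷ as) (a∈K ∷ as∈K) comb∈S =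
    ¬¬-excluded-middle >>= λ where
      (yes a≈0) → ¬¬-map (a≈0 ∷_)
                           (independent as as∈K (IsSubspace.resp S-subspace (drop-head a≈0) comb∈S))
      (no a≉0)  → ⊥-elim (u∉span (head∈spanMod S-subspace a∈K a≉0 as∈K comb∈S))
    where
    drop-head : a ≈ 0# → a ·v u +v lincomb as vs ≋ lincomb as vs
    drop-head a≈0 = ≋-trans (+v-cong (≋-trans (·v-cong a≈0 ≋-refl) (·v-zeroˡ u)) ≋-refl) (+v-identityˡ _)

  ratio∈K : ∀ {k} {g y : V k} {a a′ l} → ¬ y ≋ 0v → K a → K a′ →
            y ≋ a ·v g → l ·v y ≋ a′ ·v g → ¬ ¬ K l
  ratio∈K {g = g} {y} {a} {a′} {l} y≢0 a∈K a′∈K y≋ag ly≋a′g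
    with proj₂ F-field a (λ a≈0 → y≢0 (≋-trans y≋ag (≋-trans (·v-cong a≈0 ≋-refl) (·v-zeroˡ g))))
  ... | e , ae≈1 =
    ¬¬-map (λ l≈a′e → K.resp (sym l≈a′e) (K.*-closed a′∈K (K.inv-closed a∈K ae≈1)))
           (·v-cancelʳ y≢0 ly≋a′e·y)
    where
    a′ea≈a′ : (a′ * e) * a ≈ a′
    a′ea≈a′ = trans (*-assoc a′ e a) (trans (*-congˡ (trans (*-comm e a) ae≈1)) (*-identityʳ a′))
    ly≋a′e·y : l ·v y ≋ (a′ * e) ·v y
    ly≋a′e·y = begin
      l ·v y               ≈⟨ ly≋a′g ⟩
      a′ ·v g              ≈⟨ ·v-cong a′ea≈a′ ≋-refl ⟨
      ((a′ * e) * a) ·v g  ≈⟨ ·v-assoc (a′ * e) a g ⟩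
      (a′ * e) ·v a ·v g   ≈⟨ ·v-cong refl y≋ag ⟨
      (a′ * e) ·v y        ∎
      where open ≋-Reasoning

  weight-one⇒scalar∈K : ∀ {k r} {U : Pred (V k) r} {y l} → ¬ y ≋ 0v → HasWeight K U y 1 →
                        U y → U (l ·v y) → ¬ ¬ K l
  weight-one⇒scalar∈K {y = y} {l} y≢0 (g ∷ [] , _ , _ , spans) y∈U ly∈U
    with spans y (y∈U , 1# , ≋-sym (·v-identityˡ y)) | spans (l ·v y) (ly∈U , l , ≋-refl)
  ... | a ∷ [] , a∈K ∷ [] , y≋ag+0 | a′ ∷ [] , a′∈K ∷ [] , ly≋a′g+0 =
    ratio∈K y≢0 a∈K a′∈K (≋-trans y≋ag+0 (+v-identityʳ _)) (≋-trans ly≋a′g+0 (+v-identityʳ _))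

-- Imported only here: from now on _+_ and _*_ are the operations on ℕ, not those of the field.
open import Data.Nat using (_+_; _*_; _∸_)
open import Data.Nat.Properties
  using (≤-refl; +-suc; +-identityʳ; *-monoʳ-≤; +-monoˡ-≤; m≤m+n; module ≤-Reasoning)
open import Data.Nat.Tactic.RingSolver using (solve-∀)

2n≤m[k∸1]+2m : ∀ m {k n t} → 1 ≤ k → n ≤ m + t → t + (t + m) ≤ m * k →
               2 * n ≤ m * (k ∸ 1) + 2 * m
2n≤m[k∸1]+2m m {suc k} {n} {t} _ n≤m+t 2t+m≤mk = begin
  2 * n            ≤⟨ *-monoʳ-≤ 2 n≤m+t ⟩
  2 * (m + t)      ≡⟨ regroup m t ⟩
  t + (t + m) + m  ≤⟨ +-monoˡ-≤ m 2t+m≤mk ⟩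
  m * suc k + m    ≡⟨ unfold m k ⟩
  m * k + 2 * m    ∎
  where
  open ≤-Reasoning
  regroup : ∀ m t → 2 * (m + t) ≡ t + (t + m) + m
  regroup = solve-∀
  unfold : ∀ m k → m * suc k + m ≡ m * k + 2 * m
  unfold = solve-∀

module BasesModulo {c ℓ p} {F : CommutativeRing c ℓ} (F-field : Over.IsField F)
                   {K : Pred (CommutativeRing.Carrier F) p} (K-subfield : Over.IsSubfield F K) where
  open LinearAlgebra F
  open Subspaces F-field K-subfield

  record BasisMod {k r s} (W : Pred (V k) r) (S : Pred (V k) s) : Set (c ⊔ ℓ ⊔ p ⊔ r ⊔ s) where
    field
      size        : ℕ
      basis       : Vec (V k) size
      basis⊆W     : All W basis
      independent : IndependentMod S basis
      spanning    : ∀ u → W u → ¬ ¬ InSpanMod S basis u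

  basisMod-exists : ∀ {k r s} {W : Pred (V k) r} {S : Pred (V k) s} → IsSubspace K S → ∀ B →
                    (∀ {M} (vs : Vec (V k) M) → All W vs → IndependentMod S vs → M ≤ B) →
                    ¬ ¬ BasisMod W S
  basisMod-exists {k} {W = W} {S} S-subspace B bounded = grow B [] [] (λ { [] [] _ → return [] }) ≤-refl
    where
    grow   : ∀ r {M} (vs : Vec (V k) M) → All W vs → IndependentMod S vs → B ≤ M + r →
             ¬ ¬ BasisMod W S
    extend : ∀ r {M} (vs : Vec (V k) (suc M)) → All W vs → IndependentMod S vs → B ≤ M + r →
             ¬ ¬ BasisMod W S

    grow r vs vs⊆W independent B≤M+r = ¬¬-excluded-middle >>= λ where
      (yes spanning) → return record
        { basis = vs ; basis⊆W = vs⊆W ; independent = independent ; spanning = spanning }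
      (no ¬spanning) → do
        (u , u∈W , u∉span) ← ¬∀¬¬⇒¬¬∃¬ ¬spanning
        extend r (u ∷ vs) (u∈W ∷ vs⊆W) (∉span⇒independentMod-∷ S-subspace independent u∉span) B≤M+r

    extend zero    {M} vs vs⊆W independent B≤M+0 _ =
      n≮n M (≤-trans (bounded vs vs⊆W independent) (≡.subst (B ≤_) (+-identityʳ M) B≤M+0))
    extend (suc r) {M} vs vs⊆W independent B≤M+1+r =
      grow r vs vs⊆W independent (≡.subst (B ≤_) (+-suc M r) B≤M+1+r)

module Counting {c ℓ p} {F : CommutativeRing c ℓ} (F-field : Over.IsField F)
                {K : Pred (CommutativeRing.Carrier F) p} (K-subfield : Over.IsSubfield F K)
                {q} (1<q : 1 < q) (K-size : Over.HasSize F K q) where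
  open CommutativeRing F using (Carrier)
  open LinearAlgebra F
  open Subspaces F-field K-subfield
  open Tuples K-size

  independent⇒q^≤ : ∀ {k M L} {vs : Vec (V k) M} → Independent vs → (E : Fin L → V k) →
                    (∀ as → All K as → ¬ ¬ ∃ λ j → lincomb as vs ≋ E j) → q ^ M ≤ L
  independent⇒q^≤ {M = M} {L} {vs} independent E hits = decidable-stable (q ^ M ≤? L) (do
    choice ← ¬¬-Π-Fin (q ^ M) λ t → hits (tuple M t) (tuple∈P M t)
    return (injective⇒≤ (injective choice)))
    where
    injective : (choice : ∀ t → ∃ λ j → lincomb (tuple M t) vs ≋ E j) →
                ∀ {t t′} → proj₁ (choice t) ≡ proj₁ (choice t′) → t ≡ t′
    injective choice {t} {t′} same = decidable-stable (t ≟ᶠ t′) (¬¬-map (tuple-injective M)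
      (independent⇒lincomb-injective independent (tuple∈P M t) (tuple∈P M t′) combinations≋))
      where
      combinations≋ : lincomb (tuple M t) vs ≋ lincomb (tuple M t′) vs
      combinations≋ = ≋-trans (proj₂ (choice t))
        (≡.subst (λ j → E j ≋ lincomb (tuple M t′) vs) (≡.sym same) (≋-sym (proj₂ (choice t′))))

  independent≤spanning : ∀ {k r M M′} {W : Pred (V k) r} {vs : Vec (V k) M} {ws : Vec (V k) M′} →
                         IsSubspace K W → All W vs → Independent vs → Spans W ws → M ≤ M′
  independent≤spanning {M′ = M′} {vs = vs} {ws} W-subspace vs⊆W independent spans =
    ^-cancelˡ-≤ q 1<q (independent⇒q^≤ independent (λ t → lincomb (tuple M′ t) ws) hits)
    where
    hits : ∀ as → All K as → ¬ ¬ ∃ λ t → lincomb as vs ≋ lincomb (tuple M′ t) ws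
    hits as as∈K = do
      (bs , bs∈K , comb≋) ← spans _ (lincomb∈ W-subspace as∈K vs⊆W)
      let t , t≋bs = tuple-surjective bs∈K
      return (t , ≋-trans comb≋ (lincomb-cong ws (≋-sym t≋bs)))

  independent≤m*k : ∀ m {k M} {vs : Vec (V k) M} → HasSize (λ _ → Carrier) (q ^ m) →
                    Independent vs → M ≤ m * k
  independent≤m*k m {k} {M} {vs} F-size independent =
    ^-cancelˡ-≤ q 1<q
      (≡.subst (q ^ M ≤_) (^-*-assoc q m k) (independent⇒q^≤ independent (Fᵏ.tuple k) hits))
    where
    module Fᵏ = Tuples F-size
    hits : ∀ as → All K as → ¬ ¬ ∃ λ t → lincomb as vs ≋ Fᵏ.tuple k t
    hits as _ =
      let t , t≋ = Fᵏ.tuple-surjective (All.universal (λ x → x) (lincomb as vs))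
      in return (t , ≋-sym t≋)

module Club {c ℓ p r} {F : CommutativeRing c ℓ} (F-field : Over.IsField F)
            {K : Pred (CommutativeRing.Carrier F) p} (K-subfield : Over.IsSubfield F K)
            {q m k n : ℕ} (1<q : 1 < q)
            (F-size : Over.HasSize F (λ _ → CommutativeRing.Carrier F) (q ^ m)) (K-size : Over.HasSize F K q)
            {U : Pred (Over.V F k) r} (U-subspace : Over.IsSubspace F K U) (U-dim : Over.HasDim F K U n)
            (club : Over.IsClub F K U m) where
  open CommutativeRing F using (_≈_; 0#; refl)
  open LinearAlgebra F
  open Subspaces F-field K-subfield
  open BasesModulo F-field K-subfield
  open Counting F-field K-subfield 1<q K-size

  u₀ : V k
  u₀ = proj₁ club

  u₀-weight : HasWeight K U u₀ m
  u₀-weight = proj₁ (proj₂ (proj₂ (proj₂ club)))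

  unique : ∀ u → U u → ¬ u ≋ 0v → HasWeight K U u m → SamePoint u u₀
  unique = proj₁ (proj₂ (proj₂ (proj₂ (proj₂ club))))

  others : ∀ u → U u → ¬ u ≋ 0v → ¬ SamePoint u u₀ → HasWeight K U u 1
  others = proj₂ (proj₂ (proj₂ (proj₂ (proj₂ club))))

  ⟨u₀⟩-subspace : IsSubspace K ⟨ u₀ ⟩
  ⟨u₀⟩-subspace = line-subspace u₀

  cs : Vec (V k) m
  cs = proj₁ u₀-weight

  cs⊆U : All U cs
  cs⊆U = All.map proj₁ (proj₁ (proj₂ u₀-weight))

  cs⊆⟨u₀⟩ : All ⟨ u₀ ⟩ cs
  cs⊆⟨u₀⟩ = All.map proj₂ (proj₁ (proj₂ u₀-weight))

  off-line⇒weight-one : ∀ {y} → U y → ¬ ⟨ u₀ ⟩ y → HasWeight K U y 1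
  off-line⇒weight-one {y} y∈U y∉⟨u₀⟩ =
    others y y∈U (∉subspace⇒≢0 ⟨u₀⟩-subspace y∉⟨u₀⟩)
           λ (a , _ , y≋au₀) → y∉⟨u₀⟩ (a , y≋au₀)

  m≡1⇒U⊆⟨u₀⟩ : m ≡ 1 → ∀ {y} → U y → ¬ ¬ ⟨ u₀ ⟩ y
  m≡1⇒U⊆⟨u₀⟩ m≡1 {y} y∈U y∉⟨u₀⟩ =
    let weight-m = ≡.subst (HasWeight K U y) (≡.sym m≡1) (off-line⇒weight-one y∈U y∉⟨u₀⟩)
        a , _ , y≋au₀ = unique y y∈U (∉subspace⇒≢0 ⟨u₀⟩-subspace y∉⟨u₀⟩) weight-m
    in y∉⟨u₀⟩ (a , y≋au₀)

  K=F⇒m≤1 : (∀ a → ¬ ¬ K a) → m ≤ 1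
  K=F⇒m≤1 all∈K =
    independent≤spanning ⟨u₀⟩-subspace cs⊆⟨u₀⟩ (basis-independent u₀-weight) spans
    where
    spans : Spans ⟨ u₀ ⟩ (u₀ ∷ [])
    spans x (a , x≋au₀) =
      ¬¬-map (λ a∈K → a ∷ [] , a∈K ∷ [] , ≋-trans x≋au₀ (≋-sym (+v-identityʳ _))) (all∈K a)

  basisMod : ¬ ¬ BasisMod U ⟨ u₀ ⟩
  basisMod = basisMod-exists ⟨u₀⟩-subspace n λ vs vs⊆U independent →
    independent≤spanning U-subspace vs⊆U (independentMod⇒independent ⟨u₀⟩-subspace independent)
                         (basis-spans U-dim)

  module _ (B : BasisMod U ⟨ u₀ ⟩) where
    open BasisMod B

    n≤m+size : n ≤ m + size
    n≤m+size = independent≤spanning U-subspace (proj₁ (proj₂ U-dim)) (basis-independent U-dim) spans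
      where
      spans : Spans U (cs ++ basis)
      spans x x∈U = do
        (w , w∈⟨u₀⟩ , β , β∈K , x≋w+bβ) ← spanning x x∈U
        let w∈U = ∈-cancelʳ U-subspace (lincomb∈ U-subspace β∈K basis⊆W)
                                        (IsSubspace.resp U-subspace x≋w+bβ x∈U)
        (γ , γ∈K , w≋cγ) ← basis-spans u₀-weight w (w∈U , w∈⟨u₀⟩)
        return (γ ++ β , ++⁺ γ∈K β∈K ,
                ≋-trans x≋w+bβ (≋-trans (+v-cong w≋cγ ≋-refl) (≋-sym (lincomb-++ γ β cs basis))))

    doubled-relation⇒trivial : ∀ {l} → ¬ K l → ∀ {β α γ} → All K β → All K α → All K γ →
                               l ·v lincomb β basis +v (lincomb α basis +v lincomb γ cs) ≋ 0v →
                               ¬ ¬ (All (_≈ 0#) β × All (_≈ 0#) α × All (_≈ 0#) γ)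
    doubled-relation⇒trivial {l} l∉K {β} {α} {γ} β∈K α∈K γ∈K comb≋0 =
      ¬¬-excluded-middle >>= λ where
        (no y∉⟨u₀⟩) → ⊥-elim (weight-one⇒scalar∈K (∉subspace⇒≢0 ⟨u₀⟩-subspace y∉⟨u₀⟩)
                                                  (off-line⇒weight-one y∈U y∉⟨u₀⟩) y∈U ly∈U l∉K)
        (yes y∈⟨u₀⟩) → do
          β≈0 ← independent β β∈K y∈⟨u₀⟩
          α≈0 ← independent α α∈K (x∈⟨u₀⟩ β≈0)
          γ≈0 ← basis-independent u₀-weight γ γ∈K (z≋0 β≈0 α≈0)
          return (β≈0 , α≈0 , γ≈0)
      where
      x : V k
      x = lincomb α basis
      y : V k
      y = lincomb β basis
      z : V k
      z = lincomb γ cs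
      y∈U : U y
      y∈U = lincomb∈ U-subspace β∈K basis⊆W
      ly∈U : U (l ·v y)
      ly∈U = ∈-cancelʳ U-subspace
        (IsSubspace.+-closed U-subspace (lincomb∈ U-subspace α∈K basis⊆W) (lincomb∈ U-subspace γ∈K cs⊆U))
        (≋0⇒∈ U-subspace comb≋0)
      x+z≋0 : All (_≈ 0#) β → x +v z ≋ 0v
      x+z≋0 β≈0 = begin
        x +v z              ≈⟨ +v-identityˡ _ ⟨
        0v +v (x +v z)      ≈⟨ +v-cong (·v-zeroʳ l) ≋-refl ⟨
        l ·v 0v +v (x +v z) ≈⟨ +v-cong (·v-cong refl (lincomb-zero basis β≈0)) ≋-refl ⟨
        l ·v y +v (x +v z)  ≈⟨ comb≋0 ⟩
        0v                  ∎
        where open ≋-Reasoning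
      x∈⟨u₀⟩ : All (_≈ 0#) β → ⟨ u₀ ⟩ x
      x∈⟨u₀⟩ β≈0 =
        ∈-cancelʳ ⟨u₀⟩-subspace (lincomb∈ ⟨u₀⟩-subspace γ∈K cs⊆⟨u₀⟩) (≋0⇒∈ ⟨u₀⟩-subspace (x+z≋0 β≈0))
      z≋0 : All (_≈ 0#) β → All (_≈ 0#) α → z ≋ 0v
      z≋0 β≈0 α≈0 = begin
        z          ≈⟨ +v-identityˡ z ⟨
        0v +v z    ≈⟨ +v-cong (lincomb-zero basis α≈0) ≋-refl ⟨
        x +v z     ≈⟨ x+z≋0 β≈0 ⟩
        0v         ∎
        where open ≋-Reasoning

    doubled-independent : ∀ {l} → ¬ K l → Independent (map (l ·v_) basis ++ (basis ++ cs))
    doubled-independent {l} l∉K coefficients coefficients∈K comb≋0 with splitAt size coefficients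
    ... | β , αγ , ≡.refl with splitAt size αγ
    ... | α , γ , ≡.refl =
      let β∈K , αγ∈K = ++⁻ β coefficients∈K
          α∈K , γ∈K  = ++⁻ α αγ∈K
      in ¬¬-map (λ (β≈0 , α≈0 , γ≈0) → ++⁺ β≈0 (++⁺ α≈0 γ≈0))
                (doubled-relation⇒trivial l∉K β∈K α∈K γ∈K (≋-trans (≋-sym split) comb≋0))
      where
      split : lincomb (β ++ (α ++ γ)) (map (l ·v_) basis ++ (basis ++ cs))
              ≋ l ·v lincomb β basis +v (lincomb α basis +v lincomb γ cs)
      split = ≋-trans (lincomb-++ β (α ++ γ) _ _)
                      (+v-cong (lincomb-map-·v l β basis) (lincomb-++ α γ basis cs))

    size≡0 : m ≡ 1 → size ≡ 0
    size≡0 m≡1 = empty basis basis⊆W independent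
      where
      empty : ∀ {M} (vs : Vec (V k) M) → All U vs → IndependentMod ⟨ u₀ ⟩ vs → M ≡ 0
      empty []      _         _             = ≡.refl
      empty (y ∷ _) (y∈U ∷ _) y∷-independent =
        ⊥-elim (m≡1⇒U⊆⟨u₀⟩ m≡1 y∈U (independentMod⇒head∉ ⟨u₀⟩-subspace y∷-independent))

    size+[size+m]≤m*k : 1 ≤ m → 1 ≤ k → size + (size + m) ≤ m * k
    size+[size+m]≤m*k 1≤m 1≤k = decidable-stable (size + (size + m) ≤? m * k) (do
      yes (l , l∉K) ← ¬¬-excluded-middle {A = ∃ λ l → ¬ K l}
        where no ∄l∉K → let m≡1 = ≤-antisym (K=F⇒m≤1 λ a a∉K → ∄l∉K (a , a∉K)) 1≤m
                        in return (degenerate (size≡0 m≡1) m≡1)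
      return (independent≤m*k m F-size (doubled-independent l∉K)))
      where
      degenerate : ∀ {t μ} → t ≡ 0 → μ ≡ 1 → t + (t + μ) ≤ μ * k
      degenerate ≡.refl ≡.refl = ≤-trans 1≤k (m≤m+n k 0)

proposition4p10 : ∀ {c ℓ p r : Level} (q m k n : ℕ) → IsPrimePower q → 1 ≤ m → 3 ≤ k
    → (F : CommutativeRing c ℓ) → Over.IsField F
    → Over.HasSize F (λ _ → CommutativeRing.Carrier F) (q ^ m)
    → (K : Pred (CommutativeRing.Carrier F) p) → Over.IsSubfield F K → Over.HasSize F K q
    → (U : Pred (Over.V F k) r) → Over.IsSubspace F K U → Over.HasDim F K U n
    → Over.IsClub F K U m
    → 2 * n ≤ m * (k ∸ 1) + 2 * m
proposition4p10 q m k n q-primePower 1≤m 3≤k F F-field F-size K K-subfield K-size U U-subspace U-dim club =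
  decidable-stable (2 * n ≤? m * (k ∸ 1) + 2 * m)
    (¬¬-map (λ B → 2n≤m[k∸1]+2m m 1≤k (n≤m+size B) (size+[size+m]≤m*k B 1≤m 1≤k)) basisMod)
  where
  open Club F-field K-subfield (primePower>1 q-primePower) F-size K-size U-subspace U-dim club
  1≤k : 1 ≤ k
  1≤k = ≤-trans (s≤s z≤n) 3≤k
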